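{- A generalised clause-set $F$ is an unsatisfiable hitting clause-set if and only if $\varphi*F$ is minimally unsatisfiable for every partial assignment $\varphi$.
   Context: Each variable $v$ has a finite non-empty domain $D_v$; a literal is a pair $(v,\varepsilon)$, $\varepsilon\in D_v$, meaning "$v\ne\varepsilon$"; a clause is a finite set of literals with no two distinct literals on the same variable; a clause-set is a finite set of clauses. A partial assignment $\varphi$ maps finitely many variables to values in their domains; it satisfies $(v,\varepsilon)$ iff $\varphi(v)$ is defined and $\ne\varepsilon$, falsifies it iff $\varphi(v)=\varepsilon$. For a clause-set $F$, $\varphi*F$ is the clause-set obtained by removing all clauses containing a satisfied literal and removing all falsified literals from the remaining clauses (coinciding results merged). Two clauses clash if they contain literals $(v,\varepsilon),(v,\varepsilon')$ with $\varepsilon\ne\varepsilon'$. $F$ is a hitting clause-set if every two distinct clauses of $F$ clash. $F$ is minimally unsatisfiable if unsatisfiable and every proper subset is satisfiable. -}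

module Defs where

open import Data.Nat using (ℕ; _<_; _≡ᵇ_)
open import Data.Bool using (Bool; true; false; not; if_then_else_)
open import Data.Maybe using (Maybe; just; nothing)
open import Data.Product using (_×_; _,_; proj₁; proj₂; Σ; ∃; ∃-syntax)
open import Data.List using (List; []; _∷_; map; filterᵇ)
open import Data.Bool.ListAction using (any)
open import Data.List.Membership.Propositional using (_∈_)
open import Data.List.Relation.Unary.All using (All)
open import Data.List.Relation.Unary.Any using (Any)
open import Data.List.Relation.Binary.Subset.Propositional using (_⊆_)
open import Relation.Binary.PropositionalEquality using (_≡_; _≢_)
open import Relation.Nullary using (¬_)

-- Variables are natural numbers; a domain assignment Dom : ℕ → ℕ gives the
-- size of the domain of each variable, D_v = {0, …, Dom v - 1}.
Var : Set
Var = ℕ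

Val : Set
Val = ℕ

-- literal (v , ε) meaning "v ≠ ε"
Lit : Set
Lit = Var × Val

-- clauses and clause-sets are finite sets, represented by lists
-- (order and repetitions irrelevant; equality of clauses is set equality)
Clause : Set
Clause = List Lit

ClauseSet : Set
ClauseSet = List Clause

_≈C_ : Clause → Clause → Set
C ≈C D = (C ⊆ D) × (D ⊆ C)

WfLit : (ℕ → ℕ) → Lit → Set
WfLit Dom (v , ε) = ε < Dom v

WfClause : (ℕ → ℕ) → Clause → Set
WfClause Dom C =
  All (WfLit Dom) C × (∀ {l l′} → l ∈ C → l′ ∈ C → proj₁ l ≡ proj₁ l′ → l ≡ l′)

WfClauseSet : (ℕ → ℕ) → ClauseSet → Set
WfClauseSet Dom F = All (WfClause Dom) F

PAss : Set
PAss = List (Var × Val)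

WfPAss : (ℕ → ℕ) → PAss → Set
WfPAss Dom φ =
  All (λ p → proj₂ p < Dom (proj₁ p)) φ
  × (∀ {p q} → p ∈ φ → q ∈ φ → proj₁ p ≡ proj₁ q → p ≡ q)

lookupPA : PAss → Var → Maybe Val
lookupPA [] v = nothing
lookupPA ((w , e) ∷ φ) v = if w ≡ᵇ v then just e else lookupPA φ v

satLit : PAss → Lit → Bool
satLit φ (v , ε) with lookupPA φ v
... | just e  = not (e ≡ᵇ ε)
... | nothing = false

falsLit : PAss → Lit → Bool
falsLit φ (v , ε) with lookupPA φ v
... | just e  = e ≡ᵇ ε
... | nothing = false

-- φ * F : drop clauses with a satisfied literal, remove falsified literals
-- (merging of coinciding clauses is implicit in the set reading of lists)
_*_ : PAss → ClauseSet → ClauseSet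
φ * F = map (filterᵇ (λ l → not (falsLit φ l))) (filterᵇ (λ C → not (any (satLit φ) C)) F)

Satisfiable : (ℕ → ℕ) → ClauseSet → Set
Satisfiable Dom F = ∃[ φ ] (WfPAss Dom φ × (φ * F ≡ []))

Unsatisfiable : (ℕ → ℕ) → ClauseSet → Set
Unsatisfiable Dom F = ¬ Satisfiable Dom F

_⊆CS_ : ClauseSet → ClauseSet → Set
G ⊆CS F = ∀ {C} → C ∈ G → Any (C ≈C_) F

_⊂CS_ : ClauseSet → ClauseSet → Set
G ⊂CS F = (G ⊆CS F) × (∃[ C ] (C ∈ F × ¬ Any (C ≈C_) G))

MinimallyUnsatisfiable : (ℕ → ℕ) → ClauseSet → Set
MinimallyUnsatisfiable Dom F =
  Unsatisfiable Dom F × (∀ G → G ⊂CS F → Satisfiable Dom G)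

Clash : Clause → Clause → Set
Clash C D = ∃[ v ] ∃[ ε ] ∃[ ε′ ] ((v , ε) ∈ C × (v , ε′) ∈ D × ε ≢ ε′)

Hitting : ClauseSet → Set
Hitting F = ∀ {C D} → C ∈ F → D ∈ F → ¬ (C ≈C D) → Clash C D

-- Read a clause C as the partial assignment v ↦ ε for (v , ε) ∈ C: it is the
-- least assignment falsifying C, and it satisfies exactly the clauses clashing
-- with C.
--
-- (⇒) If ψ satisfies φ * F then φ extended by ψ satisfies F, so φ * F stays
-- unsatisfiable. Two clauses of F that survive φ and clash on v are both
-- unsatisfied, so φ leaves v unassigned and the clash survives: φ * F is
-- hitting. In a hitting clause-set, the assignment C satisfies every clause
-- other than C, so dropping any clause makes it satisfiable.
--
-- (⇐) φ = [] gives unsatisfiability. For clauses X, Y of F, X * F contains the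
-- empty clause, hence by minimality no other clause. So either X satisfies Y,
-- and X, Y clash, or X falsifies all of Y, i.e. Y ⊆ X. Two clauses that do not
-- clash therefore contain each other.

module Submission where

open import Defs
open import Data.Nat using (ℕ; _<_; _≡ᵇ_; _≟_)
open import Data.Nat.Properties using (≡ᵇ⇒≡; ≡⇒≡ᵇ)
open import Data.Bool using (Bool; true; false; not; T)
open import Data.Bool.ListAction using (any)
open import Data.Unit using (tt)
open import Data.Empty using (⊥-elim)
open import Data.Maybe using (just; nothing; is-nothing; _<∣>_)
open import Data.Maybe.Properties using (just-injective)
open import Data.Product using (_×_; _,_; proj₁; proj₂; ∃-syntax)
open import Data.Sum using (_⊎_; inj₁; inj₂)
open import Data.List using ([]; _∷_; map; filterᵇ; _++_)
open import Data.List.Properties using (filter-all; filter-none; map-id-local)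
open import Data.List.Membership.Propositional using (_∈_; find; lose)
open import Data.List.Membership.Propositional.Properties
  using (∈-map⁺; ∈-++⁻; ∈-filter⁺; ∈-filter⁻; ∈-map∘filter⁻)
open import Data.List.Relation.Unary.All as All using (All; [])
open import Data.List.Relation.Unary.All.Properties using (++⁺; map⁺; filter⁺)
open import Data.List.Relation.Unary.Any as Any using (Any; here; there)
open import Data.List.Relation.Unary.Any.Properties using (any⁺; any⁻)
open import Data.List.Relation.Binary.Subset.Propositional using (_⊆_)
open import Data.List.Relation.Binary.Subset.Propositional.Properties
  using (All-resp-⊇; filter-⊆; filter⁺′)
open import Function.Base using (_∘_; id)
open import Function.Bundles using (_⇔_; mk⇔; Equivalence)
open import Relation.Nullary using (¬_; yes; no; contradiction)
open import Relation.Nullary.Decidable using (T?)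
open import Relation.Binary.PropositionalEquality
  using (_≡_; _≢_; refl; sym; trans; cong; subst; module ≡-Reasoning)

T-not⇔¬T : ∀ {b} → T (not b) ⇔ (¬ T b)
T-not⇔¬T {false} = mk⇔ (λ _ ()) (λ _ → tt)
T-not⇔¬T {true}  = mk⇔ (λ ()) (λ ¬t → ¬t tt)

T⇒¬T-not : ∀ {b} → T b → ¬ T (not b)
T⇒¬T-not t t-not = Equivalence.to T-not⇔¬T t-not t

≢⇒T-not-≡ᵇ : ∀ m n → m ≢ n → T (not (m ≡ᵇ n))
≢⇒T-not-≡ᵇ m n m≢n with m ≡ᵇ n | ≡ᵇ⇒≡ m n
... | true  | m≡n = m≢n (m≡n tt)
... | false | _   = tt

T-not-≡ᵇ⇒≢ : ∀ m n → T (not (m ≡ᵇ n)) → m ≢ n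
T-not-≡ᵇ⇒≢ m n with m ≡ᵇ n | ≡⇒≡ᵇ m n
... | true  | _    = λ ()
... | false | m≡ᵇn = λ _ m≡n → m≡ᵇn m≡n

module _ (φ : PAss) {v : Var} {ε : Val} where

  satLit-just : ∀ {e} → lookupPA φ v ≡ just e → e ≢ ε → T (satLit φ (v , ε))
  satLit-just {e} φv≡e e≢ε rewrite φv≡e = ≢⇒T-not-≡ᵇ e ε e≢ε

  satLit⁻ : T (satLit φ (v , ε)) → ∃[ e ] lookupPA φ v ≡ just e × e ≢ ε
  satLit⁻ with lookupPA φ v
  ... | just e  = λ s → e , refl , T-not-≡ᵇ⇒≢ e ε s
  ... | nothing = λ ()

  falsLit-just : lookupPA φ v ≡ just ε → T (falsLit φ (v , ε))
  falsLit-just φv≡ε rewrite φv≡ε = ≡⇒≡ᵇ ε ε refl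

  falsLit⁻ : T (falsLit φ (v , ε)) → lookupPA φ v ≡ just ε
  falsLit⁻ with lookupPA φ v
  ... | just e  = λ f → cong just (≡ᵇ⇒≡ e ε f)
  ... | nothing = λ ()

  falsLit-nothing : lookupPA φ v ≡ nothing → ¬ T (falsLit φ (v , ε))
  falsLit-nothing φv≡nothing f with trans (sym φv≡nothing) (falsLit⁻ f)
  ... | ()

  unassigned-if-undetermined : ¬ T (satLit φ (v , ε)) → ¬ T (falsLit φ (v , ε)) →
    lookupPA φ v ≡ nothing
  unassigned-if-undetermined ¬sat ¬fals with lookupPA φ v
  ... | nothing = refl
  ... | just e with e ≟ ε
  ...   | yes refl = contradiction (≡⇒≡ᵇ e e refl) ¬fals
  ...   | no e≢ε   = contradiction (≢⇒T-not-≡ᵇ e ε e≢ε) ¬sat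

  unassigned-if-unsatisfied-clash : ∀ {ε′} → ε ≢ ε′ →
    ¬ T (satLit φ (v , ε)) → ¬ T (satLit φ (v , ε′)) → lookupPA φ v ≡ nothing
  unassigned-if-unsatisfied-clash {ε′} ε≢ε′ ¬sat ¬sat′ with lookupPA φ v
  ... | nothing = refl
  ... | just e with e ≟ ε
  ...   | yes refl = contradiction (≢⇒T-not-≡ᵇ e ε′ ε≢ε′) ¬sat′
  ...   | no e≢ε   = contradiction (≢⇒T-not-≡ᵇ e ε e≢ε) ¬sat

Functional : PAss → Set
Functional φ = ∀ {p q} → p ∈ φ → q ∈ φ → proj₁ p ≡ proj₁ q → p ≡ q

lookupPA-∈ : ∀ {φ v e} → Functional φ → (v , e) ∈ φ → lookupPA φ v ≡ just e
lookupPA-∈ {(w , d) ∷ φ} {v} fun ve∈φ with w ≡ᵇ v | ≡ᵇ⇒≡ w v | ≡⇒≡ᵇ w v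
... | true  | w≡v | _ = cong (just ∘ proj₂) (fun (here refl) ve∈φ (w≡v tt))
... | false | _ | w≢v with ve∈φ
...   | here refl   = ⊥-elim (w≢v refl)
...   | there ve∈φ′ = lookupPA-∈ (λ p q → fun (there p) (there q)) ve∈φ′

∈-lookupPA : ∀ φ {v e} → lookupPA φ v ≡ just e → (v , e) ∈ φ
∈-lookupPA ((w , d) ∷ φ) {v} φv≡e with w ≡ᵇ v | ≡ᵇ⇒≡ w v
... | true  | w≡v with refl ← w≡v tt | refl ← φv≡e = here refl
... | false | _ = there (∈-lookupPA φ φv≡e)

functional-if-lookupPA-∈ : ∀ {φ} →
  (∀ {v e} → (v , e) ∈ φ → lookupPA φ v ≡ just e) → Functional φ
functional-if-lookupPA-∈ look {v , e} {.v , e′} p q refl =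
  cong (v ,_) (just-injective (trans (sym (look p)) (look q)))

lookupPA-++ : ∀ φ ψ v → lookupPA (φ ++ ψ) v ≡ (lookupPA φ v <∣> lookupPA ψ v)
lookupPA-++ []             ψ v = refl
lookupPA-++ ((w , d) ∷ φ) ψ v with w ≡ᵇ v
... | true  = refl
... | false = lookupPA-++ φ ψ v

lookupPA-filterᵇ : ∀ p ψ v → (∀ e → T (p (v , e))) →
  lookupPA (filterᵇ p ψ) v ≡ lookupPA ψ v
lookupPA-filterᵇ p []             v keeps = refl
lookupPA-filterᵇ p ((w , d) ∷ ψ) v keeps with p (w , d) in keep
... | true with w ≡ᵇ v
...   | true  = refl
...   | false = lookupPA-filterᵇ p ψ v keeps
lookupPA-filterᵇ p ((w , d) ∷ ψ) v keeps | false with w ≡ᵇ v | ≡ᵇ⇒≡ w v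
...   | false | _   = lookupPA-filterᵇ p ψ v keeps
...   | true  | w≡v with refl ← w≡v tt = ⊥-elim (subst T keep (keeps d))

unassignedIn : PAss → Var × Val → Bool
unassignedIn φ (v , _) = is-nothing (lookupPA φ v)

_⊕_ : PAss → PAss → PAss
φ ⊕ ψ = φ ++ filterᵇ (unassignedIn φ) ψ

lookupPA-⊕ : ∀ φ ψ v → lookupPA (φ ⊕ ψ) v ≡ (lookupPA φ v <∣> lookupPA ψ v)
lookupPA-⊕ φ ψ v = trans (lookupPA-++ φ _ v) restrict
  where
  restrict : (lookupPA φ v <∣> lookupPA (filterᵇ (unassignedIn φ) ψ) v)
           ≡ (lookupPA φ v <∣> lookupPA ψ v)
  restrict with lookupPA φ v in φv
  ... | just _  = refl
  ... | nothing = lookupPA-filterᵇ (unassignedIn φ) ψ v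
                    (λ _ → subst (T ∘ is-nothing) (sym φv) tt)

⊕-wf : ∀ {Dom φ ψ} → WfPAss Dom φ → WfPAss Dom ψ → WfPAss Dom (φ ⊕ ψ)
⊕-wf {φ = φ} {ψ} (φ-dom , φ-fun) (ψ-dom , ψ-fun) =
  ++⁺ φ-dom (All-resp-⊇ (filter-⊆ (T? ∘ unassignedIn φ) ψ) ψ-dom) ,
  functional-if-lookupPA-∈ lookup-member
  where
  lookup-member : ∀ {v e} → (v , e) ∈ φ ⊕ ψ → lookupPA (φ ⊕ ψ) v ≡ just e
  lookup-member {v} m rewrite lookupPA-⊕ φ ψ v with ∈-++⁻ φ m
  ... | inj₁ m∈φ rewrite lookupPA-∈ φ-fun m∈φ = refl
  ... | inj₂ m∈ψ′ with ∈-filter⁻ (T? ∘ unassignedIn φ) m∈ψ′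
  ...   | m∈ψ , unassigned with lookupPA φ v
  -- the case just is absurd: there unassigned : T false
  ...     | nothing = lookupPA-∈ ψ-fun m∈ψ

reduce : PAss → Clause → Clause
reduce φ = filterᵇ (λ l → not (falsLit φ l))

reduce-∈⁺ : ∀ {φ C l} → l ∈ C → ¬ T (falsLit φ l) → l ∈ reduce φ C
reduce-∈⁺ l∈C ¬fals = ∈-filter⁺ (T? ∘ _) l∈C (Equivalence.from T-not⇔¬T ¬fals)

reduce-∈⁻ : ∀ {φ C l} → l ∈ reduce φ C → l ∈ C × ¬ T (falsLit φ l)
reduce-∈⁻ l∈φC with l∈C , kept ← ∈-filter⁻ (T? ∘ _) l∈φC =
  l∈C , Equivalence.to T-not⇔¬T kept

reduce-mono : ∀ φ {C D} → C ⊆ D → reduce φ C ⊆ reduce φ D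
reduce-mono φ = filter⁺′ (T? ∘ _) (T? ∘ _) id

reduce-cong : ∀ φ {C D} → C ≈C D → reduce φ C ≈C reduce φ D
reduce-cong φ (C⊆D , D⊆C) = reduce-mono φ C⊆D , reduce-mono φ D⊆C

reduce-≡[]⇒⊆ : ∀ φ C → reduce φ C ≡ [] → C ⊆ φ
reduce-≡[]⇒⊆ φ C φC≡[] {v , ε} vε∈C with T? (falsLit φ (v , ε))
... | yes fals = ∈-lookupPA φ (falsLit⁻ φ fals)
... | no ¬fals with () ← subst ((v , ε) ∈_) φC≡[] (reduce-∈⁺ {φ} vε∈C ¬fals)

_⊨_ : PAss → ClauseSet → Set
φ ⊨ F = All (T ∘ any (satLit φ)) F

*-∈⁺ : ∀ φ F {C} → C ∈ F → ¬ T (any (satLit φ) C) → reduce φ C ∈ φ * F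
*-∈⁺ φ F C∈F φ⊭C =
  ∈-map⁺ (reduce φ) (∈-filter⁺ (T? ∘ _) C∈F (Equivalence.from T-not⇔¬T φ⊭C))

*-∈⁻ : ∀ φ F {C′} → C′ ∈ φ * F →
  ∃[ C ] C ∈ F × C′ ≡ reduce φ C × ¬ T (any (satLit φ) C)
*-∈⁻ φ F C′∈φF with C , C∈F , refl , kept ← ∈-map∘filter⁻ (reduce φ) (T? ∘ _) C′∈φF =
  C , C∈F , refl , Equivalence.to T-not⇔¬T kept

*≡[]⇒⊨ : ∀ φ F → φ * F ≡ [] → φ ⊨ F
*≡[]⇒⊨ φ F φF≡[] = All.tabulate satisfied
  where
  satisfied : ∀ {C} → C ∈ F → T (any (satLit φ) C)
  satisfied {C} C∈F with T? (any (satLit φ) C)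
  ... | yes φ⊨C = φ⊨C
  ... | no φ⊭C with () ← subst (reduce φ C ∈_) φF≡[] (*-∈⁺ φ F C∈F φ⊭C)

⊨⇒*≡[] : ∀ φ F → φ ⊨ F → φ * F ≡ []
⊨⇒*≡[] φ F φ⊨F = cong (map (reduce φ)) (filter-none (T? ∘ _) (All.map T⇒¬T-not φ⊨F))

unsatisfied-literal : ∀ {φ C l} → ¬ T (any (satLit φ) C) → l ∈ C → ¬ T (satLit φ l)
unsatisfied-literal φ⊭C l∈C φ⊨l = φ⊭C (any⁺ _ (lose l∈C φ⊨l))

satLit-⊕ˡ : ∀ φ ψ {l} → T (satLit φ l) → T (satLit (φ ⊕ ψ) l)
satLit-⊕ˡ φ ψ {v , ε} φ⊨l with e , φv≡e , e≢ε ← satLit⁻ φ φ⊨l =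
  satLit-just (φ ⊕ ψ) (trans (lookupPA-⊕ φ ψ v) (cong (_<∣> lookupPA ψ v) φv≡e)) e≢ε

satLit-⊕ʳ : ∀ φ ψ {v ε} → lookupPA φ v ≡ nothing →
  T (satLit ψ (v , ε)) → T (satLit (φ ⊕ ψ) (v , ε))
satLit-⊕ʳ φ ψ {v} φv≡nothing ψ⊨l with e , ψv≡e , e≢ε ← satLit⁻ ψ ψ⊨l =
  satLit-just (φ ⊕ ψ) φ⊕ψv≡e e≢ε
  where
  open ≡-Reasoning
  φ⊕ψv≡e : lookupPA (φ ⊕ ψ) v ≡ just e
  φ⊕ψv≡e = begin
    lookupPA (φ ⊕ ψ) v            ≡⟨ lookupPA-⊕ φ ψ v ⟩
    lookupPA φ v <∣> lookupPA ψ v ≡⟨ cong (_<∣> lookupPA ψ v) φv≡nothing ⟩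
    lookupPA ψ v                  ≡⟨ ψv≡e ⟩
    just e                        ∎

⊨-*⇒⊨-⊕ : ∀ φ ψ F → ψ ⊨ (φ * F) → (φ ⊕ ψ) ⊨ F
⊨-*⇒⊨-⊕ φ ψ F ψ⊨φF = All.tabulate satisfied
  where
  satisfied : ∀ {C} → C ∈ F → T (any (satLit (φ ⊕ ψ)) C)
  satisfied {C} C∈F with T? (any (satLit φ) C)
  ... | yes φ⊨C = any⁺ (satLit (φ ⊕ ψ)) (Any.map (satLit-⊕ˡ φ ψ) (any⁻ _ C φ⊨C))
  ... | no φ⊭C
    with (v , ε) , l∈φC , ψ⊨l
           ← find (any⁻ (satLit ψ) (reduce φ C) (All.lookup ψ⊨φF (*-∈⁺ φ F C∈F φ⊭C)))
    with l∈C , ¬fals ← reduce-∈⁻ {φ} {C} l∈φC =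
    any⁺ (satLit (φ ⊕ ψ)) (lose l∈C (satLit-⊕ʳ φ ψ φv≡nothing ψ⊨l))
    where
    φv≡nothing : lookupPA φ v ≡ nothing
    φv≡nothing = unassigned-if-undetermined φ (unsatisfied-literal {φ} {C} φ⊭C l∈C) ¬fals

*-preserves-unsatisfiable : ∀ {Dom φ F} → WfPAss Dom φ →
  Unsatisfiable Dom F → Unsatisfiable Dom (φ * F)
*-preserves-unsatisfiable {φ = φ} {F} wfφ unsatF (ψ , wfψ , ψφF≡[]) =
  unsatF (φ ⊕ ψ , ⊕-wf wfφ wfψ , ⊨⇒*≡[] (φ ⊕ ψ) F φ⊕ψ⊨F)
  where
  φ⊕ψ⊨F : (φ ⊕ ψ) ⊨ F
  φ⊕ψ⊨F = ⊨-*⇒⊨-⊕ φ ψ F (*≡[]⇒⊨ ψ (φ * F) ψφF≡[])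

WfClause-resp-⊇ : ∀ {Dom C D} → D ⊆ C → WfClause Dom C → WfClause Dom D
WfClause-resp-⊇ D⊆C (C-dom , C-fun) =
  All-resp-⊇ D⊆C C-dom , λ p q → C-fun (D⊆C p) (D⊆C q)

*-preserves-wf : ∀ {Dom} φ F → WfClauseSet Dom F → WfClauseSet Dom (φ * F)
*-preserves-wf φ F wfF =
  map⁺ (filter⁺ (T? ∘ _) (All.map (WfClause-resp-⊇ (filter-⊆ (T? ∘ _) _)) wfF))

*-preserves-hitting : ∀ φ {F} → Hitting F → Hitting (φ * F)
*-preserves-hitting φ {F} hitF C′∈φF D′∈φF C′≉D′
  with C , C∈F , refl , φ⊭C ← *-∈⁻ φ F C′∈φF
  with D , D∈F , refl , φ⊭D ← *-∈⁻ φ F D′∈φF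
  with v , ε , ε′ , vε∈C , vε′∈D , ε≢ε′ ← hitF C∈F D∈F (C′≉D′ ∘ reduce-cong φ) =
  v , ε , ε′ , reduce-∈⁺ {φ} vε∈C (falsLit-nothing φ φv≡nothing) ,
  reduce-∈⁺ {φ} vε′∈D (falsLit-nothing φ φv≡nothing) , ε≢ε′
  where
  φv≡nothing : lookupPA φ v ≡ nothing
  φv≡nothing = unassigned-if-unsatisfied-clash φ ε≢ε′
    (unsatisfied-literal {φ} {C} φ⊭C vε∈C) (unsatisfied-literal {φ} {D} φ⊭D vε′∈D)

clause-wf : ∀ {Dom C} → WfClause Dom C → WfPAss Dom C
clause-wf (C-dom , C-fun) = All.map (λ {(v , ε)} ε<Dom → ε<Dom) C-dom , C-fun

hitting⇒proper-subsets-satisfiable : ∀ {Dom F} → WfClauseSet Dom F → Hitting F →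
  ∀ G → G ⊂CS F → Satisfiable Dom G
hitting⇒proper-subsets-satisfiable {Dom} {F} wfF hitF G (G⊆F , C , C∈F , C∉G) =
  C , wfC , ⊨⇒*≡[] C G (All.tabulate satisfied)
  where
  wfC : WfPAss Dom C
  wfC = clause-wf (All.lookup wfF C∈F)
  representative-≉C : ∀ {E E′} → E ∈ G → E ≈C E′ → ¬ (E′ ≈C C)
  representative-≉C E∈G (E⊆E′ , E′⊆E) (E′⊆C , C⊆E′) =
    C∉G (lose E∈G (E′⊆E ∘ C⊆E′ , E′⊆C ∘ E⊆E′))
  satisfied : ∀ {E} → E ∈ G → T (any (satLit C) E)
  satisfied E∈G
    with E′ , E′∈F , E≈E′ ← find (G⊆F E∈G)
    with v , ε , ε′ , vε∈E′ , vε′∈C , ε≢ε′ ← hitF E′∈F C∈F (representative-≉C E∈G E≈E′) =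
    any⁺ (satLit C) (lose (proj₂ E≈E′ vε∈E′) C⊨vε)
    where
    C⊨vε : T (satLit C (v , ε))
    C⊨vε = satLit-just C (lookupPA-∈ (proj₂ wfC) vε′∈C) (ε≢ε′ ∘ sym)

[]*-identity : ∀ F → [] * F ≡ F
[]*-identity F = begin
  [] * F
    ≡⟨ cong (map (reduce [])) (filter-all (T? ∘ _) (All.tabulate λ {C} _ → kept {C})) ⟩
  map (reduce []) F
    ≡⟨ map-id-local (All.tabulate λ _ → unreduced) ⟩
  F ∎
  where
  open ≡-Reasoning
  kept : ∀ {C} → T (not (any (satLit []) C))
  kept {C} = Equivalence.from T-not⇔¬T λ []⊨C →
    let (v , ε) , _ , []⊨l = find (any⁻ (satLit []) C []⊨C) in []⊨l
  unreduced : ∀ {C} → reduce [] C ≡ C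
  unreduced = filter-all (T? ∘ _) (All.tabulate λ {(v , ε)} _ → tt)

[]∈⇒unsatisfiable : ∀ {Dom F} → [] ∈ F → Unsatisfiable Dom F
[]∈⇒unsatisfiable {F = F} []∈F (ψ , _ , ψF≡[]) = All.lookup (*≡[]⇒⊨ ψ F ψF≡[]) []∈F

minimally-unsatisfiable-∋[]⇒all-empty : ∀ {Dom G C} →
  MinimallyUnsatisfiable Dom G → [] ∈ G → C ∈ G → C ≡ []
minimally-unsatisfiable-∋[]⇒all-empty {C = []}    _             _    _    = refl
minimally-unsatisfiable-∋[]⇒all-empty {Dom} {G} {l ∷ C} (_ , minimal) []∈G lC∈G =
  ⊥-elim ([]∈⇒unsatisfiable {Dom} {[] ∷ []} (here refl)
    (minimal ([] ∷ []) (⊥⊆G , l ∷ C , lC∈G , lC∉⊥)))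
  where
  ⊥⊆G : ([] ∷ []) ⊆CS G
  ⊥⊆G (here refl) = lose []∈G ((λ ()) , (λ ()))
  lC∉⊥ : ¬ Any ((l ∷ C) ≈C_) ([] ∷ [])
  lC∉⊥ (here (lC⊆[] , _)) with () ← lC⊆[] (here refl)

[]∈self* : ∀ {C F} → Functional C → C ∈ F → [] ∈ C * F
[]∈self* {C} {F} C-fun C∈F =
  subst (_∈ C * F) self-falsified (*-∈⁺ C F C∈F unsatisfied)
  where
  falsified : ∀ {l} → l ∈ C → T (falsLit C l)
  falsified {v , ε} l∈C = falsLit-just C (lookupPA-∈ C-fun l∈C)
  self-falsified : reduce C C ≡ []
  self-falsified = filter-none (T? ∘ _) (All.tabulate (T⇒¬T-not ∘ falsified))
  unsatisfied : ¬ T (any (satLit C) C)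
  unsatisfied C⊨C
    with (v , ε) , l∈C , C⊨l ← find (any⁻ (satLit C) C C⊨C)
    with e , Cv≡e , e≢ε ← satLit⁻ C C⊨l =
    e≢ε (just-injective (trans (sym Cv≡e) (lookupPA-∈ C-fun l∈C)))

satisfied-by-clause⇒clash : ∀ X Y → T (any (satLit X) Y) → Clash X Y
satisfied-by-clause⇒clash X Y X⊨Y
  with (v , ε′) , vε′∈Y , X⊨l ← find (any⁻ (satLit X) Y X⊨Y)
  with e , Xv≡e , e≢ε′ ← satLit⁻ X X⊨l =
  v , e , ε′ , ∈-lookupPA X Xv≡e , vε′∈Y , e≢ε′

clash-or-⊆ : ∀ {Dom F X Y} → Functional X → X ∈ F → Y ∈ F →
  MinimallyUnsatisfiable Dom (X * F) → Clash X Y ⊎ Y ⊆ X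
clash-or-⊆ {F = F} {X} {Y} X-fun X∈F Y∈F muXF with T? (any (satLit X) Y)
... | yes X⊨Y = inj₁ (satisfied-by-clause⇒clash X Y X⊨Y)
... | no X⊭Y  = inj₂ (reduce-≡[]⇒⊆ X Y
  (minimally-unsatisfiable-∋[]⇒all-empty muXF ([]∈self* X-fun X∈F) (*-∈⁺ X F Y∈F X⊭Y)))

Clash-sym : ∀ {C D} → Clash C D → Clash D C
Clash-sym (v , ε , ε′ , vε∈C , vε′∈D , ε≢ε′) =
  v , ε′ , ε , vε′∈D , vε∈C , ε≢ε′ ∘ sym

hitting-if-clash-or-⊆ : ∀ {F} →
  (∀ {X Y} → X ∈ F → Y ∈ F → Clash X Y ⊎ Y ⊆ X) → Hitting F
hitting-if-clash-or-⊆ clash-or-⊆ C∈F D∈F C≉D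
  with clash-or-⊆ C∈F D∈F | clash-or-⊆ D∈F C∈F
... | inj₁ clash | _          = clash
... | inj₂ _     | inj₁ clash = Clash-sym clash
... | inj₂ D⊆C   | inj₂ C⊆D   =
  contradiction ((λ {l} → C⊆D {l}) , (λ {l} → D⊆C {l})) C≉D

corollary2p4p9 : (Dom : ℕ → ℕ) → (∀ v → 0 < Dom v) →
    (F : ClauseSet) → WfClauseSet Dom F →
    (Unsatisfiable Dom F × Hitting F)
      ⇔ (∀ φ → WfPAss Dom φ → MinimallyUnsatisfiable Dom (φ * F))
corollary2p4p9 Dom _ F wfF = mk⇔ reductions-minimally-unsatisfiable unsatisfiable-hitting
  where
  reductions-minimally-unsatisfiable : Unsatisfiable Dom F × Hitting F →
    ∀ φ → WfPAss Dom φ → MinimallyUnsatisfiable Dom (φ * F)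
  reductions-minimally-unsatisfiable (unsatF , hitF) φ wfφ =
    *-preserves-unsatisfiable {φ = φ} {F} wfφ unsatF ,
    hitting⇒proper-subsets-satisfiable (*-preserves-wf φ F wfF) (*-preserves-hitting φ hitF)

  unsatisfiable-hitting : (∀ φ → WfPAss Dom φ → MinimallyUnsatisfiable Dom (φ * F)) →
    Unsatisfiable Dom F × Hitting F
  unsatisfiable-hitting mu =
    subst (Unsatisfiable Dom) ([]*-identity F) (proj₁ (mu [] ([] , λ ()))) ,
    hitting-if-clash-or-⊆ λ X∈F Y∈F → let wfX = All.lookup wfF X∈F in
      clash-or-⊆ (proj₂ wfX) X∈F Y∈F (mu _ (clause-wf wfX))
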